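{- Let $A$ and $B$ be two independent sets of the same size in a graph $G$. If the Piran graph $\Pi(A,B)$ is even-hole-free, then there exists a vertex in $B\setminus A$ with at most one neighbor in $A\setminus B$.
   Context: The Piran graph $\Pi(A,B)$ is the subgraph of $G$ induced by $(A\setminus B)\cup(B\setminus A)$. A hole is a chordless (induced) cycle with at least four vertices; it is even if it has an even number of vertices. A graph is even-hole-free if it contains no even hole as an induced subgraph. -}

module Defs where

open import Data.Nat using (ℕ; suc; _+_; _%_)
open import Data.Nat.Divisibility using (_∣_)
open import Data.Fin using (Fin; toℕ)
open import Data.Fin.Subset using (Subset; _∈_; _∪_; _─_)
open import Data.Product using (Σ; _×_)
open import Data.Sum using (_⊎_)
open import Function using (_⇔_)
open import Function.Definitions using (Injective)
open import Relation.Binary.PropositionalEquality using (_≡_)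
open import Relation.Binary.Definitions using (Decidable)
open import Relation.Nullary using (¬_)

record Graph (n : ℕ) : Set₁ where
  field
    Adj     : Fin n → Fin n → Set
    adj?    : Decidable Adj
    sym     : ∀ {u v} → Adj u v → Adj v u
    irrefl  : ∀ {u} → ¬ Adj u u
open Graph public

module _ {n : ℕ} (G : Graph n) where

  Independent : Subset n → Set
  Independent S = ∀ {u v} → u ∈ S → v ∈ S → ¬ Adj G u v

  CycNext : {m : ℕ} → Fin (suc m) → Fin (suc m) → Set
  CycNext {m} i j = toℕ j ≡ suc (toℕ i) % suc m

  -- A hole of G of length (4 + m) whose vertices all lie in S: an injective
  -- cyclic sequence of vertices in S in which two vertices are adjacent in G
  -- iff they are consecutive on the cycle (i.e. an induced cycle of the
  -- subgraph of G induced by S).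
  record HoleIn (S : Subset n) (m : ℕ) : Set where
    field
      vtx     : Fin (4 + m) → Fin n
      inj     : Injective _≡_ _≡_ vtx
      inS     : ∀ i → vtx i ∈ S
      chordless : ∀ i j → (Adj G (vtx i) (vtx j) ⇔ (CycNext i j ⊎ CycNext j i))

  EvenHoleFreeInduced : Subset n → Set
  EvenHoleFreeInduced S = ∀ m → 2 ∣ (4 + m) → ¬ HoleIn S m

  PiranVertices : Subset n → Subset n → Subset n
  PiranVertices A B = (A ─ B) ∪ (B ─ A)

  PiranEvenHoleFree : Subset n → Subset n → Set
  PiranEvenHoleFree A B = EvenHoleFreeInduced (PiranVertices A B)

  AtMostOneNbrIn : Fin n → Subset n → Set
  AtMostOneNbrIn v S = ∀ {u w} → u ∈ S → w ∈ S → Adj G v u → Adj G v w → u ≡ w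

-- Suppose every vertex of B ∖ A has two neighbours in A ∖ B.  While some x ∈ A ∖ B has at most
-- one neighbour in B ∖ A, delete x together with that neighbour: every remaining vertex of B ∖ A
-- keeps two neighbours on the other side, and |A ∖ B| ≤ |B ∖ A| persists.  When this stops, both
-- sides are nonempty and every vertex has two neighbours on the other side.  Grow an induced path
-- greedily: a neighbour w of its end, other than the previous vertex, either extends it or is
-- adjacent to an earlier path vertex, and the last such vertex closes a hole through w.  The
-- graph is bipartite, so that hole is even.
module Submission where

open import Defs renaming (sym to adj-sym)
open import Data.Empty using (⊥-elim)
open import Data.Fin using (Fin; toℕ)
open import Data.Fin.Properties using (any?; pigeonhole; toℕ-injective; toℕ<n) renaming (_≟_ to _≟ᶠ_)
open import Data.Fin.Subset
  using (Subset; _∈_; _∉_; _⊆_; _─_; _-_; _∩_; ⁅_⁆; ∣_∣; Nonempty; inside; outside)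
open import Data.Fin.Subset.Properties
  using ( _∈?_; nonempty?; Empty-unique; ∣⊥∣≡0; p─⊥≡p; ∩-comm; ⊆-trans; ⊆-antisym; p─q⊆p; p⊆p∪q; q⊆p∪q
        ; ∣p─q∣≤∣p∣; x∈p∧x∉q⇒x∈p─q; x∈p∧x≢y⇒x∈p-y; x∉⁅y⁆⇒x≢y; x∈p⇒∣p-x∣<∣p∣)
open import Data.Nat using (ℕ; zero; suc; pred; _+_; _≤_; _<_; z≤n; s≤s; s≤s⁻¹; _%_; _≟_; parity)
open import Data.Nat.DivMod using (m<n⇒m%n≡m; n%n≡0)
open import Data.Nat.Divisibility using (_∣_; divides; ∣-refl; ∣m∣n⇒∣m+n)
open import Data.Nat.Induction using (<-wellFounded)
open import Data.Nat.Properties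
  using ( ≤-refl; ≤-reflexive; ≤-trans; <⇒≤; <⇒≢; <⇒≱; ≰⇒>; ≤∧≢⇒<; <-irrefl; 1+n≰n; n≮0
        ; m≤n⇒m<n∨m≡n; m<1+n⇒m<n∨m≡n; m<n⇒m<1+n; m≤n⇒∃[o]m+o≡n
        ; +-suc; +-comm; +-identityʳ; +-cancelʳ-≡; +-monoˡ-≤; +-monoˡ-<)
open import Data.Parity.Base using (Parity; 0ℙ; 1ℙ; _⁻¹)
open import Data.Parity.Properties using (⁻¹-involutive; suc-homo-⁻¹; +-homo-+) renaming (+-cancelʳ-≡ to ℙ-+-cancelʳ-≡)
open import Data.Product using (Σ; ∃; ∃₂; _×_; _,_)
open import Data.Sum using (_⊎_; inj₁; inj₂; swap) renaming (map to ⊎-map)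
open import Data.Vec using (_∷_; [])
open import Data.Vec.Base using (here; there)
open import Function using (_⇔_; mk⇔; Equivalence)
open import Induction.WellFounded using (Acc; acc)
open import Relation.Binary.PropositionalEquality
  using (_≡_; _≢_; refl; sym; trans; cong; subst; subst₂; module ≡-Reasoning)
open import Relation.Nullary using (¬_; Dec; yes; no; ¬?)
open import Relation.Nullary.Decidable using (_×-dec_; decidable-stable)

∣p∣≡∣p─q∣+∣p∩q∣ : ∀ {n} (p q : Subset n) → ∣ p ∣ ≡ ∣ p ─ q ∣ + ∣ p ∩ q ∣
∣p∣≡∣p─q∣+∣p∩q∣ []            []            = refl
∣p∣≡∣p─q∣+∣p∩q∣ (inside  ∷ p) (inside  ∷ q) = trans (cong suc (∣p∣≡∣p─q∣+∣p∩q∣ p q)) (sym (+-suc _ _))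
∣p∣≡∣p─q∣+∣p∩q∣ (inside  ∷ p) (outside ∷ q) = cong suc (∣p∣≡∣p─q∣+∣p∩q∣ p q)
∣p∣≡∣p─q∣+∣p∩q∣ (outside ∷ p) (inside  ∷ q) = ∣p∣≡∣p─q∣+∣p∩q∣ p q
∣p∣≡∣p─q∣+∣p∩q∣ (outside ∷ p) (outside ∷ q) = ∣p∣≡∣p─q∣+∣p∩q∣ p q

∣p∣≡∣q∣⇒∣p─q∣≡∣q─p∣ : ∀ {n} (p q : Subset n) → ∣ p ∣ ≡ ∣ q ∣ → ∣ p ─ q ∣ ≡ ∣ q ─ p ∣
∣p∣≡∣q∣⇒∣p─q∣≡∣q─p∣ p q ∣p∣≡∣q∣ = +-cancelʳ-≡ ∣ p ∩ q ∣ _ _ (begin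
  ∣ p ─ q ∣ + ∣ p ∩ q ∣ ≡⟨ sym (∣p∣≡∣p─q∣+∣p∩q∣ p q) ⟩
  ∣ p ∣                 ≡⟨ ∣p∣≡∣q∣ ⟩
  ∣ q ∣                 ≡⟨ ∣p∣≡∣p─q∣+∣p∩q∣ q p ⟩
  ∣ q ─ p ∣ + ∣ q ∩ p ∣ ≡⟨ cong (λ r → ∣ q ─ p ∣ + ∣ r ∣) (∩-comm q p) ⟩
  ∣ q ─ p ∣ + ∣ p ∩ q ∣ ∎)
  where open ≡-Reasoning

x∈p⇒∣p∣≡1+∣p-x∣ : ∀ {n} {x : Fin n} (p : Subset n) → x ∈ p → ∣ p ∣ ≡ suc ∣ p - x ∣
x∈p⇒∣p∣≡1+∣p-x∣ (inside  ∷ p) here      = cong suc (sym (cong ∣_∣ (p─⊥≡p p)))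
x∈p⇒∣p∣≡1+∣p-x∣ (inside  ∷ p) (there x∈p) = cong suc (x∈p⇒∣p∣≡1+∣p-x∣ p x∈p)
x∈p⇒∣p∣≡1+∣p-x∣ (outside ∷ p) (there x∈p) = x∈p⇒∣p∣≡1+∣p-x∣ p x∈p

x∈p─q⇒x∉q : ∀ {n} {x : Fin n} (p q : Subset n) → x ∈ p ─ q → x ∉ q
x∈p─q⇒x∉q (_ ∷ p) (inside ∷ q) ()          here
x∈p─q⇒x∉q (_ ∷ p) (_      ∷ q) (there x∈) (there x∈q) = x∈p─q⇒x∉q p q x∈ x∈q

Nonempty-∣∣-mono : ∀ {n} {p q : Subset n} → ∣ p ∣ ≤ ∣ q ∣ → Nonempty p → Nonempty q
Nonempty-∣∣-mono {n} {q = q} ∣p∣≤∣q∣ (x , x∈p) with nonempty? q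
... | yes nonempty = nonempty
... | no  empty    = ⊥-elim (n≮0 (≤-trans (x∈p⇒∣p-x∣<∣p∣ x∈p) ∣p∣≤0))
  where
  ∣p∣≤0 = ≤-trans ∣p∣≤∣q∣ (≤-reflexive (trans (cong ∣_∣ (Empty-unique empty)) (∣⊥∣≡0 n)))

¬Nonempty[p─q]⇒p⊆q : ∀ {n} {p q : Subset n} → ¬ Nonempty (p ─ q) → p ⊆ q
¬Nonempty[p─q]⇒p⊆q {q = q} empty {x} x∈p with x ∈? q
... | yes x∈q = x∈q
... | no  x∉q = ⊥-elim (empty (x , x∈p∧x∉q⇒x∈p─q x∈p x∉q))

∣p∣≡∣q∣∧p≢q⇒Nonempty[p─q] : ∀ {n} {p q : Subset n} → ∣ p ∣ ≡ ∣ q ∣ → p ≢ q → Nonempty (p ─ q)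
∣p∣≡∣q∣∧p≢q⇒Nonempty[p─q] {p = p} {q} ∣p∣≡∣q∣ p≢q with nonempty? (p ─ q) | nonempty? (q ─ p)
... | yes p─q≠∅ | _         = p─q≠∅
... | no  _     | yes q─p≠∅ =
  Nonempty-∣∣-mono (≤-reflexive (sym (∣p∣≡∣q∣⇒∣p─q∣≡∣q─p∣ p q ∣p∣≡∣q∣))) q─p≠∅
... | no  p─q=∅ | no  q─p=∅ = ⊥-elim (p≢q (⊆-antisym (¬Nonempty[p─q]⇒p⊆q p─q=∅) (¬Nonempty[p─q]⇒p⊆q q─p=∅)))

parity≡0ℙ⇒2∣ : ∀ d → parity d ≡ 0ℙ → 2 ∣ d
parity≡0ℙ⇒2∣ zero          _    = divides 0 refl
parity≡0ℙ⇒2∣ (suc (suc d)) even = ∣m∣n⇒∣m+n ∣-refl (parity≡0ℙ⇒2∣ d even)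

parity-suc : ∀ k → parity (suc k) ≡ parity k ⁻¹
parity-suc k = trans (sym (⁻¹-involutive (parity (suc k)))) (cong _⁻¹ (suc-homo-⁻¹ k))

parity[d+i]≡parity[i]⇒parity[d]≡0ℙ : ∀ d i → parity (d + i) ≡ parity i → parity d ≡ 0ℙ
parity[d+i]≡parity[i]⇒parity[d]≡0ℙ d i eq = ℙ-+-cancelʳ-≡ (parity i) _ _ (trans (sym (+-homo-+ d i)) eq)

module _ {P : ℕ → Set} (P? : ∀ i → Dec (P i)) where

  greatestBelow? : ∀ k →
    (∃ λ i → i < k × P i × (∀ {j} → i < j → j < k → ¬ P j)) ⊎ (∀ {j} → j < k → ¬ P j)
  greatestBelow? zero = inj₂ λ ()
  greatestBelow? (suc k) with P? k | greatestBelow? k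
  ... | yes pₖ | _ = inj₁ (k , ≤-refl , pₖ , λ k<j j<1+k _ → <⇒≱ k<j (s≤s⁻¹ j<1+k))
  ... | no ¬pₖ | inj₁ (i , i<k , pᵢ , noneAbove) = inj₁ (i , m<n⇒m<1+n i<k , pᵢ , noneAbove′)
    where
    noneAbove′ : ∀ {j} → i < j → j < suc k → ¬ P j
    noneAbove′ i<j j<1+k with m<1+n⇒m<n∨m≡n j<1+k
    ... | inj₁ j<k  = noneAbove i<j j<k
    ... | inj₂ refl = ¬pₖ
  ... | no ¬pₖ | inj₂ none = inj₂ none′
    where
    none′ : ∀ {j} → j < suc k → ¬ P j
    none′ j<1+k with m<1+n⇒m<n∨m≡n j<1+k
    ... | inj₁ j<k  = none j<k
    ... | inj₂ refl = ¬pₖ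

module _ {a} {A : Set a} where

  _[_]≔_ : (ℕ → A) → ℕ → A → ℕ → A
  (f [ k ]≔ x) i with i ≟ k
  ... | yes _ = x
  ... | no  _ = f i

  []≔-updates : ∀ (f : ℕ → A) k x → (f [ k ]≔ x) k ≡ x
  []≔-updates f k x with k ≟ k
  ... | yes _   = refl
  ... | no  k≢k = ⊥-elim (k≢k refl)

  []≔-minimal : ∀ (f : ℕ → A) {i k} x → i ≢ k → (f [ k ]≔ x) i ≡ f i
  []≔-minimal f {i} {k} x i≢k with i ≟ k
  ... | yes i≡k = ⊥-elim (i≢k i≡k)
  ... | no  _   = refl

module _ {n : ℕ} (G : Graph n) where

  infix 4 _~_
  _~_ : Fin n → Fin n → Set
  _~_ = Adj G

  ~-sym : ∀ {u v} → u ~ v → v ~ u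
  ~-sym = adj-sym G

  ⇔-flip : ∀ {u v} {Q R : Set} → u ~ v ⇔ (Q ⊎ R) → v ~ u ⇔ (R ⊎ Q)
  ⇔-flip e = mk⇔ (λ v~u → swap (Equivalence.to e (~-sym v~u))) (λ r⊎q → ~-sym (Equivalence.from e (swap r⊎q)))

  Independent-⊆ : ∀ {S T} → S ⊆ T → Independent G T → Independent G S
  Independent-⊆ S⊆T indT u∈S v∈S = indT (S⊆T u∈S) (S⊆T v∈S)

  EvenHoleIn : Subset n → Set
  EvenHoleIn S = ∃ λ m → 2 ∣ 4 + m × HoleIn G S m

  TwoNbrsIn : Fin n → Subset n → Set
  TwoNbrsIn v S = ∃₂ λ u w → u ∈ S × w ∈ S × u ≢ w × v ~ u × v ~ w

  twoNbrsIn? : ∀ v S → Dec (TwoNbrsIn v S)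
  twoNbrsIn? v S = any? λ u → any? λ w →
    u ∈? S ×-dec w ∈? S ×-dec ¬? (u ≟ᶠ w) ×-dec adj? G v u ×-dec adj? G v w

  ¬TwoNbrsIn⇒AtMostOneNbrIn : ∀ {v S} → ¬ TwoNbrsIn v S → AtMostOneNbrIn G v S
  ¬TwoNbrsIn⇒AtMostOneNbrIn ¬two {u} {w} u∈S w∈S v~u v~w with u ≟ᶠ w
  ... | yes u≡w = u≡w
  ... | no  u≢w = ⊥-elim (¬two (u , w , u∈S , w∈S , u≢w , v~u , v~w))

  deficient⊎allTwoNbrsIn : ∀ X Y → (∃ λ x → x ∈ X × ¬ TwoNbrsIn x Y) ⊎ (∀ {x} → x ∈ X → TwoNbrsIn x Y)
  deficient⊎allTwoNbrsIn X Y with any? (λ x → x ∈? X ×-dec ¬? (twoNbrsIn? x Y))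
  ... | yes deficient = inj₁ deficient
  ... | no  none      = inj₂ λ {x} x∈X → decidable-stable (twoNbrsIn? x Y) (λ ¬two → none (x , x∈X , ¬two))

  TwoNbrsIn⇒Nonempty[S-x] : ∀ {v S} x → TwoNbrsIn v S → Nonempty (S - x)
  TwoNbrsIn⇒Nonempty[S-x] x (u , w , u∈S , w∈S , u≢w , _) with u ≟ᶠ x
  ... | yes u≡x = w , x∈p∧x≢y⇒x∈p-y w∈S (λ w≡x → u≢w (trans u≡x (sym w≡x)))
  ... | no  u≢x = u , x∈p∧x≢y⇒x∈p-y u∈S u≢x

  TwoNbrsIn-remove : ∀ {v S x} → TwoNbrsIn v S → ¬ v ~ x → TwoNbrsIn v (S - x)
  TwoNbrsIn-remove {v} {x = x} (u , w , u∈S , w∈S , u≢w , v~u , v~w) v≁x =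
    u , w , x∈p∧x≢y⇒x∈p-y u∈S (notX v~u) , x∈p∧x≢y⇒x∈p-y w∈S (notX v~w) , u≢w , v~u , v~w
    where
    notX : ∀ {u} → v ~ u → u ≢ x
    notX v~u refl = v≁x v~u

  -- Induced paths

  record IsInducedPath (p : ℕ → Fin n) (k : ℕ) : Set where
    field
      injective   : ∀ {i j} → i ≤ k → j ≤ k → p i ≡ p j → i ≡ j
      consecutive : ∀ {i j} → i ≤ k → j ≤ k → p i ~ p j → j ≡ suc i ⊎ i ≡ suc j
      adjacent    : ∀ {i} → i < k → p i ~ p (suc i)

  module _ {p : ℕ → Fin n} {k : ℕ} (P : IsInducedPath p k) where
    open IsInducedPath P

    inducedPath-length< : k < n
    inducedPath-length< = ≰⇒> λ n≤k →
      let i , j , i<j , pᵢ≡pⱼ = pigeonhole (s≤s n≤k) (λ t → p (toℕ t))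
      in <-irrefl (injective (s≤s⁻¹ (toℕ<n i)) (s≤s⁻¹ (toℕ<n j)) pᵢ≡pⱼ) i<j

    neighbour-fresh : ∀ {w} → p k ~ w → (∀ {j} → k ≡ suc j → w ≢ p j) → ∀ {j} → j ≤ k → w ≢ p j
    neighbour-fresh pₖ~w notPrev {j} j≤k w≡pⱼ with consecutive ≤-refl j≤k (subst (p k ~_) w≡pⱼ pₖ~w)
    ... | inj₁ refl  = 1+n≰n j≤k
    ... | inj₂ k≡1+j = notPrev k≡1+j w≡pⱼ

    extend : ∀ {w} → p k ~ w → (∀ {j} → j ≤ k → w ≢ p j) → (∀ {j} → j < k → ¬ w ~ p j) →
      IsInducedPath (p [ suc k ]≔ w) (suc k)
    extend {w} pₖ~w fresh noBack = record
      { injective = injective′ ; consecutive = consecutive′ ; adjacent = adjacent′ }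
      where
      q = p [ suc k ]≔ w

      q-old : ∀ {i} → i ≤ k → q i ≡ p i
      q-old i≤k = []≔-minimal p w (<⇒≢ (s≤s i≤k))

      q-new : q (suc k) ≡ w
      q-new = []≔-updates p (suc k) w

      onlyBack : ∀ {i} → i ≤ k → p i ~ w → i ≡ k
      onlyBack i≤k pᵢ~w with m≤n⇒m<n∨m≡n i≤k
      ... | inj₁ i<k = ⊥-elim (noBack i<k (~-sym pᵢ~w))
      ... | inj₂ i≡k = i≡k

      injective′ : ∀ {i j} → i ≤ suc k → j ≤ suc k → q i ≡ q j → i ≡ j
      injective′ i≤ j≤ qᵢ≡qⱼ with m≤n⇒m<n∨m≡n i≤ | m≤n⇒m<n∨m≡n j≤
      ... | inj₁ (s≤s i≤k) | inj₁ (s≤s j≤k) = injective i≤k j≤k (trans (sym (q-old i≤k)) (trans qᵢ≡qⱼ (q-old j≤k)))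
      ... | inj₁ (s≤s i≤k) | inj₂ refl = ⊥-elim (fresh i≤k (trans (sym q-new) (trans (sym qᵢ≡qⱼ) (q-old i≤k))))
      ... | inj₂ refl | inj₁ (s≤s j≤k) = ⊥-elim (fresh j≤k (trans (sym q-new) (trans qᵢ≡qⱼ (q-old j≤k))))
      ... | inj₂ refl | inj₂ refl = refl

      consecutive′ : ∀ {i j} → i ≤ suc k → j ≤ suc k → q i ~ q j → j ≡ suc i ⊎ i ≡ suc j
      consecutive′ i≤ j≤ qᵢ~qⱼ with m≤n⇒m<n∨m≡n i≤ | m≤n⇒m<n∨m≡n j≤
      ... | inj₁ (s≤s i≤k) | inj₁ (s≤s j≤k) = consecutive i≤k j≤k (subst₂ _~_ (q-old i≤k) (q-old j≤k) qᵢ~qⱼ)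
      ... | inj₁ (s≤s i≤k) | inj₂ refl =
        inj₁ (cong suc (sym (onlyBack i≤k (subst₂ _~_ (q-old i≤k) q-new qᵢ~qⱼ))))
      ... | inj₂ refl | inj₁ (s≤s j≤k) =
        inj₂ (cong suc (sym (onlyBack j≤k (~-sym (subst₂ _~_ q-new (q-old j≤k) qᵢ~qⱼ)))))
      ... | inj₂ refl | inj₂ refl = ⊥-elim (irrefl G qᵢ~qⱼ)

      adjacent′ : ∀ {i} → i < suc k → q i ~ q (suc i)
      adjacent′ (s≤s i≤k) with m≤n⇒m<n∨m≡n i≤k
      ... | inj₁ i<k  = subst₂ _~_ (sym (q-old i≤k)) (sym (q-old i<k)) (adjacent i<k)
      ... | inj₂ refl = subst₂ _~_ (sym (q-old i≤k)) (sym q-new) pₖ~w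

  shift : ∀ {p d} i → IsInducedPath p (d + i) → IsInducedPath (λ t → p (t + i)) d
  shift i P = record
    { injective   = λ a≤ b≤ e → +-cancelʳ-≡ i _ _ (injective (+-monoˡ-≤ i a≤) (+-monoˡ-≤ i b≤) e)
    ; consecutive = λ a≤ b≤ a~b →
        ⊎-map (+-cancelʳ-≡ i _ _) (+-cancelʳ-≡ i _ _) (consecutive (+-monoˡ-≤ i a≤) (+-monoˡ-≤ i b≤) a~b)
    ; adjacent    = λ a<d → adjacent (+-monoˡ-< i a<d)
    }
    where open IsInducedPath P

  closedPath⇒hole : ∀ {S m c w} → IsInducedPath c (2 + m) →
    (∀ {t} → t ≤ 2 + m → c t ∈ S) → w ∈ S → (∀ {t} → t ≤ 2 + m → w ≢ c t) →
    c 0 ~ w → c (2 + m) ~ w → (∀ {t} → 0 < t → t < 2 + m → ¬ c t ~ w) → HoleIn G S m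
  closedPath⇒hole {S} {m} {c} {w} C c∈S w∈S fresh c₀~w cₗ~w noChord = record
    { vtx = λ f → v (toℕ f)
    ; inj = λ {f} {g} e → toℕ-injective (v-injective (bound f) (bound g) e)
    ; inS = λ f → v∈S (bound f)
    ; chordless = λ f g → v-adj⇔ (bound f) (bound g)
    }
    where
    open IsInducedPath C
    v = c [ 3 + m ]≔ w

    bound : (f : Fin (4 + m)) → toℕ f ≤ 3 + m
    bound f = s≤s⁻¹ (toℕ<n f)

    v-path : ∀ {t} → t ≤ 2 + m → v t ≡ c t
    v-path t≤ = []≔-minimal c w (<⇒≢ (s≤s t≤))

    v-last : v (3 + m) ≡ w
    v-last = []≔-updates c (3 + m) w

    next : ∀ {a} → a ≤ 2 + m → suc a % (4 + m) ≡ suc a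
    next a≤ = m<n⇒m%n≡m (s≤s (s≤s a≤))

    wrap : suc (3 + m) % (4 + m) ≡ 0
    wrap = n%n≡0 (4 + m)

    v∈S : ∀ {t} → t ≤ 3 + m → v t ∈ S
    v∈S t≤ with m≤n⇒m<n∨m≡n t≤
    ... | inj₁ (s≤s t≤′) rewrite v-path t≤′ = c∈S t≤′
    ... | inj₂ refl rewrite v-last = w∈S

    v-injective : ∀ {a b} → a ≤ 3 + m → b ≤ 3 + m → v a ≡ v b → a ≡ b
    v-injective a≤ b≤ e with m≤n⇒m<n∨m≡n a≤ | m≤n⇒m<n∨m≡n b≤
    ... | inj₁ (s≤s a≤′) | inj₁ (s≤s b≤′) = injective a≤′ b≤′ (trans (sym (v-path a≤′)) (trans e (v-path b≤′)))
    ... | inj₁ (s≤s a≤′) | inj₂ refl = ⊥-elim (fresh a≤′ (trans (sym v-last) (trans (sym e) (v-path a≤′))))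
    ... | inj₂ refl | inj₁ (s≤s b≤′) = ⊥-elim (fresh b≤′ (trans (sym v-last) (trans e (v-path b≤′))))
    ... | inj₂ refl | inj₂ refl = refl

    path⇔ : ∀ {a b} → a ≤ 2 + m → b ≤ 2 + m → c a ~ c b ⇔ (b ≡ suc a % (4 + m) ⊎ a ≡ suc b % (4 + m))
    path⇔ a≤ b≤ rewrite next a≤ | next b≤ = mk⇔ (consecutive a≤ b≤) λ where
      (inj₁ refl) → adjacent b≤
      (inj₂ refl) → ~-sym (adjacent a≤)

    closing→ : ∀ {a} → a ≤ 2 + m → c a ~ w → 3 + m ≡ suc a ⊎ a ≡ 0
    closing→ {zero}  _  _    = inj₂ refl
    closing→ {suc a} a≤ cₐ~w with suc a ≟ 2 + m
    ... | yes refl = inj₁ refl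
    ... | no  a≢ = ⊥-elim (noChord (s≤s z≤n) (≤∧≢⇒< a≤ a≢) cₐ~w)

    closing⇔ : ∀ {a} → a ≤ 2 + m → c a ~ w ⇔ (3 + m ≡ suc a % (4 + m) ⊎ a ≡ suc (3 + m) % (4 + m))
    closing⇔ a≤ rewrite next a≤ | wrap = mk⇔ (closing→ a≤) λ where
      (inj₁ refl) → cₗ~w
      (inj₂ refl) → c₀~w

    loop⇔ : w ~ w ⇔ (3 + m ≡ suc (3 + m) % (4 + m) ⊎ 3 + m ≡ suc (3 + m) % (4 + m))
    loop⇔ rewrite wrap = mk⇔ (λ w~w → ⊥-elim (irrefl G w~w)) λ where
      (inj₁ ())
      (inj₂ ())

    v-adj⇔ : ∀ {a b} → a ≤ 3 + m → b ≤ 3 + m → v a ~ v b ⇔ (b ≡ suc a % (4 + m) ⊎ a ≡ suc b % (4 + m))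
    v-adj⇔ a≤ b≤ with m≤n⇒m<n∨m≡n a≤ | m≤n⇒m<n∨m≡n b≤
    ... | inj₁ (s≤s a≤′) | inj₁ (s≤s b≤′) rewrite v-path a≤′ | v-path b≤′ = path⇔ a≤′ b≤′
    ... | inj₁ (s≤s a≤′) | inj₂ refl rewrite v-path a≤′ | v-last = closing⇔ a≤′
    ... | inj₂ refl | inj₁ (s≤s b≤′) rewrite v-last | v-path b≤′ = ⇔-flip (closing⇔ b≤′)
    ... | inj₂ refl | inj₂ refl rewrite v-last = loop⇔

  -- Bipartite graphs of minimum degree two

  module _ {X Y S : Subset n} (indX : Independent G X) (indY : Independent G Y) (X⊆S : X ⊆ S) (Y⊆S : Y ⊆ S)
           (degX : ∀ {x} → x ∈ X → TwoNbrsIn x Y) (degY : ∀ {y} → y ∈ Y → TwoNbrsIn y X) where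

    side : Parity → Subset n
    side 0ℙ = X
    side 1ℙ = Y

    side⊆S : ∀ s → side s ⊆ S
    side⊆S 0ℙ = X⊆S
    side⊆S 1ℙ = Y⊆S

    ~-switches-side : ∀ s t {u v} → u ∈ side s → v ∈ side t → u ~ v → t ≡ s ⁻¹
    ~-switches-side 0ℙ 0ℙ u∈ v∈ u~v = ⊥-elim (indX u∈ v∈ u~v)
    ~-switches-side 0ℙ 1ℙ _  _  _   = refl
    ~-switches-side 1ℙ 0ℙ _  _  _   = refl
    ~-switches-side 1ℙ 1ℙ u∈ v∈ u~v = ⊥-elim (indY u∈ v∈ u~v)

    degree : ∀ s {v} → v ∈ side s → TwoNbrsIn v (side (s ⁻¹))
    degree 0ℙ = degX
    degree 1ℙ = degY

    record AlternatingPath (k : ℕ) : Set where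
      field
        vertex        : ℕ → Fin n
        isInducedPath : IsInducedPath vertex k
        alternates    : ∀ {i} → i ≤ k → vertex i ∈ side (parity i)
    open AlternatingPath

    nextNeighbour : ∀ {k} (P : AlternatingPath k) →
      ∃ λ w → w ∈ side (parity (suc k)) × vertex P k ~ w × (∀ {j} → k ≡ suc j → w ≢ vertex P j)
    nextNeighbour {k} P with degree (parity k) (alternates P ≤-refl)
    ... | u , u′ , u∈ , u′∈ , u≢u′ , pₖ~u , pₖ~u′ with u ≟ᶠ vertex P (pred k)
    ... | no  u≢prev = u , onSide u∈ , pₖ~u , λ { refl → u≢prev }
      where onSide = subst (λ s → u ∈ side s) (sym (parity-suc k))
    ... | yes u≡prev = u′ , onSide u′∈ , pₖ~u′ , λ { refl u′≡prev → u≢u′ (trans u≡prev (sym u′≡prev)) }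
      where onSide = subst (λ s → u′ ∈ side s) (sym (parity-suc k))

    extendAlternating : ∀ {k} (P : AlternatingPath k) {w} → w ∈ side (parity (suc k)) → vertex P k ~ w →
      (∀ {j} → k ≡ suc j → w ≢ vertex P j) → (∀ {j} → j < k → ¬ w ~ vertex P j) → AlternatingPath (suc k)
    extendAlternating {k} P {w} w∈ pₖ~w notPrev noBack = record
      { vertex        = vertex P [ suc k ]≔ w
      ; isInducedPath = extend path pₖ~w (neighbour-fresh path pₖ~w notPrev) noBack
      ; alternates    = alternates′
      }
      where
      path = isInducedPath P

      alternates′ : ∀ {i} → i ≤ suc k → (vertex P [ suc k ]≔ w) i ∈ side (parity i)
      alternates′ i≤ with m≤n⇒m<n∨m≡n i≤
      ... | inj₁ (s≤s i≤k) rewrite []≔-minimal (vertex P) w (<⇒≢ (s≤s i≤k)) = alternates P i≤k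
      ... | inj₂ refl      rewrite []≔-updates (vertex P) (suc k) w = w∈

    closeAlternating : ∀ {k} (P : AlternatingPath k) {w} → w ∈ side (parity (suc k)) → vertex P k ~ w →
      (∀ {j} → k ≡ suc j → w ≢ vertex P j) → ∀ {i} → i < k → w ~ vertex P i →
      (∀ {j} → i < j → j < k → ¬ w ~ vertex P j) → EvenHoleIn S
    closeAlternating {k} P {w} w∈ pₖ~w notPrev {i} i<k w~pᵢ noChord =
      let o , 1+i+o≡k = m≤n⇒∃[o]m+o≡n i<k
      in closeAt o (trans (cong suc (+-comm o i)) 1+i+o≡k)
      where
      path = isInducedPath P

      parity[i]≡parity[k] : parity i ≡ parity k
      parity[i]≡parity[k] =
        trans (~-switches-side _ _ w∈ (alternates P (<⇒≤ i<k)) w~pᵢ) (suc-homo-⁻¹ k)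

      evenGap : ∀ {d} → d + i ≡ k → parity d ≡ 0ℙ
      evenGap {d} d+i≡k =
        parity[d+i]≡parity[i]⇒parity[d]≡0ℙ d i (trans (cong parity d+i≡k) (sym parity[i]≡parity[k]))

      closeAt : ∀ o → suc o + i ≡ k → EvenHoleIn S
      closeAt zero eq with evenGap eq
      ... | ()
      closeAt (suc m) eq =
        m , ∣m∣n⇒∣m+n ∣-refl (parity≡0ℙ⇒2∣ (2 + m) (evenGap eq)) ,
        closedPath⇒hole (shift i (subst (IsInducedPath (vertex P)) (sym eq) path))
          (λ t≤ → side⊆S _ (alternates P (onPath t≤))) (side⊆S _ w∈)
          (λ t≤ → neighbour-fresh path pₖ~w notPrev (onPath t≤))
          (~-sym w~pᵢ) (subst (λ j → vertex P j ~ w) (sym eq) pₖ~w)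
          (λ 0<t t< pₜ~w → noChord (+-monoˡ-< i 0<t) (subst (_ <_) eq (+-monoˡ-< i t<)) (~-sym pₜ~w))
        where
        onPath : ∀ {t} → t ≤ 2 + m → t + i ≤ k
        onPath t≤ = subst (_ ≤_) eq (+-monoˡ-≤ i t≤)

    step : ∀ {k} → AlternatingPath k → EvenHoleIn S ⊎ AlternatingPath (suc k)
    step {k} P with nextNeighbour P
    ... | w , w∈ , pₖ~w , notPrev with greatestBelow? (λ j → adj? G w (vertex P j)) k
    ...   | inj₂ noBack = inj₂ (extendAlternating P w∈ pₖ~w notPrev noBack)
    ...   | inj₁ (i , i<k , w~pᵢ , noChord) = inj₁ (closeAlternating P w∈ pₖ~w notPrev i<k w~pᵢ noChord)

    grow : ∀ fuel {k} → n ≤ fuel + k → AlternatingPath k → EvenHoleIn S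
    grow zero        n≤k P = ⊥-elim (<⇒≱ (inducedPath-length< (isInducedPath P)) n≤k)
    grow (suc fuel) {k} n≤ P with step P
    ... | inj₁ hole = hole
    ... | inj₂ P′   = grow fuel (subst (n ≤_) (sym (+-suc fuel k)) n≤) P′

    bipartite-minDegree₂⇒evenHole : Nonempty X → EvenHoleIn S
    bipartite-minDegree₂⇒evenHole (x , x∈X) = grow n (≤-reflexive (sym (+-identityʳ n))) trivial
      where
      trivial : AlternatingPath 0
      trivial = record
        { vertex        = λ _ → x
        ; isInducedPath = record
          { injective   = λ { z≤n z≤n _ → refl }
          ; consecutive = λ _ _ x~x → ⊥-elim (irrefl G x~x)
          ; adjacent    = λ ()
          }
        ; alternates    = λ { z≤n → x∈X }
        }

  bipartite-∣X∣≤∣Y∣⇒evenHole : ∀ {X Y S} → Independent G X → Independent G Y → X ⊆ S → Y ⊆ S →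
    (∀ {y} → y ∈ Y → TwoNbrsIn y X) → ∣ X ∣ ≤ ∣ Y ∣ → Nonempty X → EvenHoleIn S
  bipartite-∣X∣≤∣Y∣⇒evenHole {X} = peel (<-wellFounded ∣ X ∣)
    where
    peel : ∀ {X Y S} → Acc _<_ ∣ X ∣ → Independent G X → Independent G Y → X ⊆ S → Y ⊆ S →
      (∀ {y} → y ∈ Y → TwoNbrsIn y X) → ∣ X ∣ ≤ ∣ Y ∣ → Nonempty X → EvenHoleIn S
    peel {X} {Y} (acc smaller) indX indY X⊆S Y⊆S degY ∣X∣≤∣Y∣ neX with deficient⊎allTwoNbrsIn X Y
    ... | inj₂ degX = bipartite-minDegree₂⇒evenHole indX indY X⊆S Y⊆S degX degY neX
    ... | inj₁ (x , x∈X , ¬two) with any? (λ y → y ∈? Y ×-dec adj? G x y)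
    ...   | no isolated = peel (smaller (x∈p⇒∣p-x∣<∣p∣ x∈X)) indX′ indY X′⊆S Y⊆S degY′
              (≤-trans (∣p─q∣≤∣p∣ X ⁅ x ⁆) ∣X∣≤∣Y∣)
              (let y , y∈Y = Nonempty-∣∣-mono ∣X∣≤∣Y∣ neX in TwoNbrsIn⇒Nonempty[S-x] x (degY y∈Y))
      where
      degY′ : ∀ {y} → y ∈ Y → TwoNbrsIn y (X - x)
      degY′ y∈Y = TwoNbrsIn-remove (degY y∈Y) (λ y~x → isolated (_ , y∈Y , ~-sym y~x))
      indX′ = Independent-⊆ (p─q⊆p X ⁅ x ⁆) indX
      X′⊆S  = ⊆-trans (p─q⊆p X ⁅ x ⁆) X⊆S
    ...   | yes (y , y∈Y , x~y) = peel (smaller (x∈p⇒∣p-x∣<∣p∣ x∈X)) indX′ indY′ X′⊆S Y′⊆S degY′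
              (s≤s⁻¹ (subst₂ _≤_ (x∈p⇒∣p∣≡1+∣p-x∣ X x∈X) (x∈p⇒∣p∣≡1+∣p-x∣ Y y∈Y) ∣X∣≤∣Y∣))
              (TwoNbrsIn⇒Nonempty[S-x] x (degY y∈Y))
      where
      degY′ : ∀ {y′} → y′ ∈ Y - y → TwoNbrsIn y′ (X - x)
      degY′ y′∈ = TwoNbrsIn-remove (degY (p─q⊆p Y ⁅ y ⁆ y′∈)) λ y′~x →
        x∉⁅y⁆⇒x≢y (x∈p─q⇒x∉q Y ⁅ y ⁆ y′∈)
          (¬TwoNbrsIn⇒AtMostOneNbrIn ¬two (p─q⊆p Y ⁅ y ⁆ y′∈) y∈Y (~-sym y′~x) x~y)
      indX′ = Independent-⊆ (p─q⊆p X ⁅ x ⁆) indX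
      indY′ = Independent-⊆ (p─q⊆p Y ⁅ y ⁆) indY
      X′⊆S  = ⊆-trans (p─q⊆p X ⁅ x ⁆) X⊆S
      Y′⊆S  = ⊆-trans (p─q⊆p Y ⁅ y ⁆) Y⊆S

lemma8 : {n : ℕ} (G : Graph n) (A B : Subset n) →
    A ≢ B →
    Independent G A → Independent G B →
    ∣ A ∣ ≡ ∣ B ∣ →
    PiranEvenHoleFree G A B →
    Σ (Fin n) λ b → (b ∈ (B ─ A)) × AtMostOneNbrIn G b (A ─ B)
lemma8 G A B A≢B indA indB ∣A∣≡∣B∣ evenHoleFree with deficient⊎allTwoNbrsIn G (B ─ A) (A ─ B)
... | inj₁ (b , b∈B─A , ¬two) = b , b∈B─A , ¬TwoNbrsIn⇒AtMostOneNbrIn G ¬two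
... | inj₂ degB─A =
  let m , even , hole = bipartite-∣X∣≤∣Y∣⇒evenHole G
        (Independent-⊆ G (p─q⊆p A B) indA) (Independent-⊆ G (p─q⊆p B A) indB)
        (p⊆p∪q (B ─ A)) (q⊆p∪q (A ─ B) (B ─ A)) degB─A
        (≤-reflexive (∣p∣≡∣q∣⇒∣p─q∣≡∣q─p∣ A B ∣A∣≡∣B∣))
        (∣p∣≡∣q∣∧p≢q⇒Nonempty[p─q] ∣A∣≡∣B∣ A≢B)
  in ⊥-elim (evenHoleFree m even hole)
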